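{- Let $\mathcal{F}\colon\mathsf{X}\to\mathsf{Y}$ be a non-trivial left adjoint functor between generalized quasi-varieties, let $\lambda$ be a cardinal and $\phi$ a $\mathsf{X}$-congruence of $\mathbf{Tm}_{\mathsf{X}}(\lambda)$ (viewed as a set of equations in variables $\{x_j:j<\lambda\}$). Let $\langle\boldsymbol\tau,\Theta\rangle$ be the contextual $\kappa$-translation of $\vDash_{\mathsf{X}}$ into $\vDash_{\mathsf{Y}}$ associated with $\mathcal{F}$ (so that the right adjoint of $\mathcal{F}$ decomposes as $\theta_{\mathscr{L}}\circ[\kappa]$). Then \[\mathcal{F}(\mathbf{Tm}_{\mathsf{X}}(\lambda)/\phi)\cong\mathbf{Tm}_{\mathsf{Y}}(\kappa\times\lambda)/\mathrm{Cg}_{\mathsf{Y}}\Big(\boldsymbol\tau^*(\phi)\cup\bigcup_{j<\lambda}\Theta(\vec x_j)\Big),\] where $\vec x_j=\langle x^i_j:i<\kappa\rangle$ and $\{x^i_j:i<\kappa,j<\lambda\}$ are the free generators of $\mathbf{Tm}_{\mathsf{Y}}(\kappa\times\lambda)$.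
   Context: Generalized quasi-varieties are classes axiomatized by a set of generalized quasi-equations (implications with possibly infinitely many equational premises) with number of variables bounded by an infinite cardinal, viewed as categories (including the empty algebra if there are no constants). A $\mathsf{K}$-congruence of $\mathbf{A}$ is a congruence $\theta$ with $\mathbf{A}/\theta\in\mathsf{K}$; $\mathrm{Cg}_{\mathsf{Y}}(S)$ is the least $\mathsf{Y}$-congruence containing $S$. A left adjoint is trivial if it sends everything to the initial object. The contextual translation associated with $\mathcal{F}$: choose $\kappa>0$ and a surjective homomorphism $\pi_1\colon\mathbf{Tm}_{\mathsf{Y}}(\kappa)\to\mathcal{F}(\mathbf{Tm}_{\mathsf{X}}(1))$ (generators $x^i$), let $\Theta$ be its kernel viewed as equations in the $x^i$; for each cardinal $n$ let $\pi_n\colon\mathbf{Tm}_{\mathsf{Y}}(\kappa\times n)\to\mathcal{F}(\mathbf{Tm}_{\mathsf{X}}(n))$ send $x^i_j$ to $\mathcal{F}(\iota_j)(\pi_1(x^i))$ where $\iota_j(x)=x_j$; for each $n$-ary $\psi\in\mathscr{L}_{\mathsf{X}}$ let $\boldsymbol\tau(\psi)\colon\mathbf{Tm}_{\mathsf{Y}}(\kappa)\to\mathbf{Tm}_{\mathsf{Y}}(\kappa\times n)$ be a homomorphism with $\pi_n\circ\boldsymbol\tau(\psi)=\mathcal{F}(\psi)\circ\pi_1$ (where $\psi\colon\mathbf{Tm}_{\mathsf{X}}(1)\to\mathbf{Tm}_{\mathsf{X}}(n)$ sends $x$ to $\psi(x_1,\dots,x_n)$), identified with the $\kappa$-sequence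 of terms $\langle\boldsymbol\tau(\psi)(x^i):i<\kappa\rangle$. Then $\boldsymbol\tau$ extends to terms by $\boldsymbol\tau_*(x_j)=\langle x^i_j:i<\kappa\rangle$, $\boldsymbol\tau_*(c)=\boldsymbol\tau(c)$, and $\boldsymbol\tau_*(\psi(\varphi_1,\dots,\varphi_n))(i)=t_i(\boldsymbol\tau_*(\varphi_1)/\vec x_1,\dots,\boldsymbol\tau_*(\varphi_n)/\vec x_n)$ when $\boldsymbol\tau(\psi)=\langle t_i\rangle$; and $\boldsymbol\tau^*(\Phi)=\{\boldsymbol\tau_*(\epsilon)(i)\approx\boldsymbol\tau_*(\delta)(i):i<\kappa,\epsilon\approx\delta\in\Phi\}$. -}

module Defs where

open import Data.Nat using (ℕ)
open import Data.Fin using (Fin)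
open import Data.Unit using (⊤; tt)
open import Data.Empty using (⊥)
open import Data.Product using (Σ; _×_; _,_; proj₁; proj₂)
open import Relation.Binary using (IsEquivalence)
open import Relation.Nullary using (¬_)

record Signature : Set₁ where
  field
    Op : Set
    ar : Op → ℕ
open Signature public

data Term (S : Signature) (V : Set) : Set where
  var : V → Term S V
  op  : (f : Op S) → (Fin (ar S f) → Term S V) → Term S V

subst : ∀ {S V W} → (V → Term S W) → Term S V → Term S W
subst σ (var x) = σ x
subst σ (op f ts) = op f (λ k → subst σ (ts k))

-- Algebras (setoid-based; the carrier may be empty)

record Algebra (S : Signature) : Set₁ where
  field
    Carrier : Set
    _≈_ : Carrier → Carrier → Set
    isEquivalence : IsEquivalence _≈_
    ⟦_⟧ : (f : Op S) → (Fin (ar S f) → Carrier) → Carrier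
    ⟦⟧-cong : ∀ f {as bs} → (∀ k → as k ≈ bs k) → ⟦ f ⟧ as ≈ ⟦ f ⟧ bs
  open IsEquivalence isEquivalence public
    renaming (refl to ≈-refl; sym to ≈-sym; trans to ≈-trans)

eval : ∀ {S V} (A : Algebra S) → (V → Algebra.Carrier A) → Term S V → Algebra.Carrier A
eval A ρ (var x) = ρ x
eval A ρ (op f ts) = Algebra.⟦_⟧ A f (λ k → eval A ρ (ts k))

record GQE (S : Signature) : Set₁ where
  field
    Var : Set
    Prem : Set
    premL premR : Prem → Term S Var
    conclL conclR : Term S Var
open GQE public

Satisfies : ∀ {S} → Algebra S → GQE S → Set
Satisfies A e =
  (ρ : Var e → Algebra.Carrier A) →
  (∀ p → Algebra._≈_ A (eval A ρ (premL e p)) (eval A ρ (premR e p))) →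
  Algebra._≈_ A (eval A ρ (conclL e)) (eval A ρ (conclR e))

record GQV : Set₁ where
  field
    sig : Signature
    Ax : Set
    axiom : Ax → GQE sig
open GQV public

record Model (K : GQV) : Set₁ where
  field
    alg : Algebra (sig K)
    sat : ∀ a → Satisfies alg (axiom K a)
open Model public

record MHom {K : GQV} (A B : Model K) : Set where
  field
    fun : Algebra.Carrier (alg A) → Algebra.Carrier (alg B)
    fun-cong : ∀ {x y} → Algebra._≈_ (alg A) x y → Algebra._≈_ (alg B) (fun x) (fun y)
    fun-hom : ∀ f as →
      Algebra._≈_ (alg B) (fun (Algebra.⟦_⟧ (alg A) f as)) (Algebra.⟦_⟧ (alg B) f (λ k → fun (as k)))
open MHom public

_≐_ : ∀ {K} {A B : Model K} → MHom A B → MHom A B → Set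
_≐_ {B = B} f g = ∀ x → Algebra._≈_ (alg B) (fun f x) (fun g x)

idM : ∀ {K} {A : Model K} → MHom A A
idM {A = A} = record
  { fun = λ x → x
  ; fun-cong = λ e → e
  ; fun-hom = λ f as → Algebra.≈-refl (alg A) }

_∘M_ : ∀ {K} {A B C : Model K} → MHom B C → MHom A B → MHom A C
_∘M_ {C = C} g f = record
  { fun = λ x → fun g (fun f x)
  ; fun-cong = λ e → fun-cong g (fun-cong f e)
  ; fun-hom = λ h as → Algebra.≈-trans (alg C) (fun-cong g (fun-hom f h as)) (fun-hom g h _) }

record ModelIso {K} (A B : Model K) : Set where
  field
    to : MHom A B
    from : MHom B A
    from∘to : (from ∘M to) ≐ idM
    to∘from : (to ∘M from) ≐ idM

record Functor (X Y : GQV) : Set₁ where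
  field
    F₀ : Model X → Model Y
    F₁ : ∀ {A B} → MHom A B → MHom (F₀ A) (F₀ B)
    F-cong : ∀ {A B} {f g : MHom A B} → f ≐ g → F₁ f ≐ F₁ g
    F-id : ∀ {A} → F₁ (idM {A = A}) ≐ idM
    F-∘ : ∀ {A B C} (g : MHom B C) (f : MHom A B) → F₁ (g ∘M f) ≐ (F₁ g ∘M F₁ f)
open Functor public

record IsLeftAdjoint {X Y : GQV} (F : Functor X Y) : Set₁ where
  field
    G : Functor Y X
    φ : ∀ {A B} → MHom (F₀ F A) B → MHom A (F₀ G B)
    ψ : ∀ {A B} → MHom A (F₀ G B) → MHom (F₀ F A) B
    φ-cong : ∀ {A B} {h k : MHom (F₀ F A) B} → h ≐ k → φ h ≐ φ k
    ψ-cong : ∀ {A B} {h k : MHom A (F₀ G B)} → h ≐ k → ψ h ≐ ψ k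
    ψφ : ∀ {A B} (h : MHom (F₀ F A) B) → ψ (φ h) ≐ h
    φψ : ∀ {A B} (h : MHom A (F₀ G B)) → φ (ψ h) ≐ h
    natural : ∀ {A A' B B'} (f : MHom A' A) (g : MHom B B') (h : MHom (F₀ F A) B) →
      φ (g ∘M (h ∘M F₁ F f)) ≐ (F₁ G g ∘M (φ h ∘M f))

IsInitial : ∀ {K} → Model K → Set₁
IsInitial {K} I = (B : Model K) → Σ (MHom I B) (λ _ → (f g : MHom I B) → f ≐ g)

NonTrivial : ∀ {X Y} → Functor X Y → Set₁
NonTrivial {X} F = ¬ ((A : Model X) → IsInitial (F₀ F A))

record Congruence (S : Signature) (V : Set) : Set₁ where
  field
    rel : Term S V → Term S V → Set
    isEquivalence : IsEquivalence rel
    compat : ∀ f {ts us} → (∀ k → rel (ts k) (us k)) → rel (op f ts) (op f us)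
open Congruence public

TermAlg : ∀ {S V} → Congruence S V → Algebra S
TermAlg {S} {V} c = record
  { Carrier = Term S V
  ; _≈_ = rel c
  ; isEquivalence = isEquivalence c
  ; ⟦_⟧ = op
  ; ⟦⟧-cong = compat c }

-- Cg K R : the least congruence on the term algebra over V containing R
-- whose quotient lies in K.
data Cg (K : GQV) {V : Set} (R : Term (sig K) V → Term (sig K) V → Set)
     : Term (sig K) V → Term (sig K) V → Set where
  base : ∀ {t u} → R t u → Cg K R t u
  cg-refl : ∀ {t} → Cg K R t t
  cg-sym : ∀ {t u} → Cg K R t u → Cg K R u t
  cg-trans : ∀ {t u v} → Cg K R t u → Cg K R u v → Cg K R t v
  cg-compat : ∀ f {ts us} → (∀ k → Cg K R (ts k) (us k)) → Cg K R (op f ts) (op f us)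
  cg-ax : ∀ a (σ : Var (axiom K a) → Term (sig K) V) →
    (∀ p → Cg K R (subst σ (premL (axiom K a) p)) (subst σ (premR (axiom K a) p))) →
    Cg K R (subst σ (conclL (axiom K a))) (subst σ (conclR (axiom K a)))

CgCong : ∀ K {V} → (Term (sig K) V → Term (sig K) V → Set) → Congruence (sig K) V
CgCong K R = record
  { rel = Cg K R
  ; isEquivalence = record { refl = cg-refl ; sym = cg-sym ; trans = cg-trans }
  ; compat = cg-compat }

private
  evalTerm : ∀ K {V W} (R : Term (sig K) W → Term (sig K) W → Set)
    (ρ : V → Term (sig K) W) (t : Term (sig K) V) →
    Cg K R (eval (TermAlg (CgCong K R)) ρ t) (subst ρ t)
  evalTerm K R ρ (var x) = cg-refl
  evalTerm K R ρ (op f ts) = cg-compat f (λ k → evalTerm K R ρ (ts k))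

CgModel : ∀ K {V} → (Term (sig K) V → Term (sig K) V → Set) → Model K
CgModel K R = record
  { alg = TermAlg (CgCong K R)
  ; sat = λ a ρ h →
      cg-trans (evalTerm K R ρ (conclL (axiom K a)))
        (cg-trans (cg-ax a ρ (λ p → cg-trans (cg-sym (evalTerm K R ρ (premL (axiom K a) p)))
                                      (cg-trans (h p) (evalTerm K R ρ (premR (axiom K a) p)))))
                  (cg-sym (evalTerm K R ρ (conclR (axiom K a))))) }

Tm : ∀ K → Set → Model K
Tm K V = CgModel K {V} (λ _ _ → ⊥)

-- K-congruences of Tm_K(V), viewed as relations on terms
record KCongruence (K : GQV) (V : Set) : Set₁ where
  field
    cong : Congruence (sig K) V
    contains-base : ∀ {t u} → Cg K (λ _ _ → ⊥) t u → rel cong t u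
    quot-sat : ∀ a → Satisfies (TermAlg cong) (axiom K a)
open KCongruence public

quotModel : ∀ {K V} → KCongruence K V → Model K
quotModel φ = record { alg = TermAlg (cong φ) ; sat = quot-sat φ }

private
  substSubst : ∀ K {U V W} (R : Term (sig K) W → Term (sig K) W → Set)
    (σ : V → Term (sig K) W) (σ' : U → Term (sig K) V) (t : Term (sig K) U) →
    Cg K R (subst σ (subst σ' t)) (subst (λ x → subst σ (σ' x)) t)
  substSubst K R σ σ' (var x) = cg-refl
  substSubst K R σ σ' (op f ts) = cg-compat f (λ k → substSubst K R σ σ' (ts k))

  substCg : ∀ K {V W} (σ : V → Term (sig K) W) {t u : Term (sig K) V} →
    Cg K (λ _ _ → ⊥) t u → Cg K (λ _ _ → ⊥) (subst σ t) (subst σ u)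
  substCg K σ (base ())
  substCg K σ cg-refl = cg-refl
  substCg K σ (cg-sym e) = cg-sym (substCg K σ e)
  substCg K σ (cg-trans e e') = cg-trans (substCg K σ e) (substCg K σ e')
  substCg K σ (cg-compat f es) = cg-compat f (λ k → substCg K σ (es k))
  substCg K σ (cg-ax a σ' hs) =
    cg-trans (ss (conclL (axiom K a)))
      (cg-trans (cg-ax a (λ x → subst σ (σ' x))
                   (λ p → cg-trans (cg-sym (ss (premL (axiom K a) p)))
                            (cg-trans (substCg K σ (hs p)) (ss (premR (axiom K a) p)))))
                (cg-sym (ss (conclR (axiom K a)))))
    where ss = substSubst K (λ _ _ → ⊥) σ σ'

  evalSubst : ∀ {S U V} (A : Algebra S) (ρ : V → Algebra.Carrier A)
    (σ : U → Term S V) (t : Term S U) →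
    Algebra._≈_ A (eval A ρ (subst σ t)) (eval A (λ x → eval A ρ (σ x)) t)
  evalSubst A ρ σ (var x) = Algebra.≈-refl A
  evalSubst A ρ σ (op f ts) = Algebra.⟦⟧-cong A f (λ k → evalSubst A ρ σ (ts k))

  evalCg : ∀ K {V} (A : Model K) (ρ : V → Algebra.Carrier (alg A)) {t u : Term (sig K) V} →
    Cg K (λ _ _ → ⊥) t u → Algebra._≈_ (alg A) (eval (alg A) ρ t) (eval (alg A) ρ u)
  evalCg K A ρ (base ())
  evalCg K A ρ cg-refl = Algebra.≈-refl (alg A)
  evalCg K A ρ (cg-sym e) = Algebra.≈-sym (alg A) (evalCg K A ρ e)
  evalCg K A ρ (cg-trans e e') = Algebra.≈-trans (alg A) (evalCg K A ρ e) (evalCg K A ρ e')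
  evalCg K A ρ (cg-compat f es) = Algebra.⟦⟧-cong (alg A) f (λ k → evalCg K A ρ (es k))
  evalCg K A ρ (cg-ax a σ hs) =
    tr (es (conclL (axiom K a)))
      (tr (sat A a (λ x → eval (alg A) ρ (σ x))
             (λ p → tr (sy (es (premL (axiom K a) p)))
                      (tr (evalCg K A ρ (hs p)) (es (premR (axiom K a) p)))))
          (sy (es (conclR (axiom K a)))))
    where
      es = evalSubst (alg A) ρ σ
      tr = Algebra.≈-trans (alg A)
      sy = Algebra.≈-sym (alg A)

substHom : ∀ K {V W} → (V → Term (sig K) W) → MHom (Tm K V) (Tm K W)
substHom K σ = record
  { fun = subst σ
  ; fun-cong = substCg K σ
  ; fun-hom = λ f as → cg-refl }

evalHom : ∀ K {V} (A : Model K) → (V → Algebra.Carrier (alg A)) → MHom (Tm K V) A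
evalHom K A ρ = record
  { fun = eval (alg A) ρ
  ; fun-cong = evalCg K A ρ
  ; fun-hom = λ f as → Algebra.≈-refl (alg A) }

module _ {X Y : GQV} (F : Functor X Y) where

  ιHom : ∀ {n} → Fin n → MHom (Tm X ⊤) (Tm X (Fin n))
  ιHom j = substHom X (λ _ → var j)

  opHom : (ψ : Op (sig X)) → MHom (Tm X ⊤) (Tm X (Fin (ar (sig X) ψ)))
  opHom ψ = substHom X (λ _ → op ψ var)

  πHom : ∀ {κ} → MHom (Tm Y κ) (F₀ F (Tm X ⊤)) → (n : ℕ) →
    MHom (Tm Y (κ × Fin n)) (F₀ F (Tm X (Fin n)))
  πHom π₁ n = evalHom Y (F₀ F (Tm X (Fin n)))
    (λ ij → fun (F₁ F (ιHom (proj₂ ij))) (fun π₁ (var (proj₁ ij))))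

  record ContextualTranslation (κ : Set) : Set₁ where
    field
      κ-pos : κ
      π₁ : MHom (Tm Y κ) (F₀ F (Tm X ⊤))
      π₁-surj : ∀ b → Σ (Term (sig Y) κ) (λ t → Algebra._≈_ (alg (F₀ F (Tm X ⊤))) (fun π₁ t) b)
      τ : (ψ : Op (sig X)) → κ → Term (sig Y) (κ × Fin (ar (sig X) ψ))
      τ-spec : ∀ ψ → (πHom π₁ (ar (sig X) ψ) ∘M substHom Y (τ ψ)) ≐ (F₁ F (opHom ψ) ∘M π₁)
  open ContextualTranslation public

  module _ {κ : Set} (T : ContextualTranslation κ) where

    Θ : Term (sig Y) κ → Term (sig Y) κ → Set
    Θ t u = Algebra._≈_ (alg (F₀ F (Tm X ⊤))) (fun (π₁ T) t) (fun (π₁ T) u)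

    τ* : ∀ {L} → Term (sig X) L → κ → Term (sig Y) (κ × L)
    τ* (var j) i = var (i , j)
    τ* (op ψ as) i = subst (λ ik → τ* (as (proj₂ ik)) (proj₁ ik)) (τ T ψ i)

    data Gen {L : Set} (φ : KCongruence X L) :
         Term (sig Y) (κ × L) → Term (sig Y) (κ × L) → Set where
      gen-τ : ∀ {ε δ} → rel (cong φ) ε δ → (i : κ) → Gen φ (τ* ε i) (τ* δ i)
      gen-Θ : (j : L) → ∀ {t u} → Θ t u →
        Gen φ (subst (λ i → var (i , j)) t) (subst (λ i → var (i , j)) u)

{-# OPTIONS --safe #-}
module Submission where

-- Write A = Tm_X(L)/φ and Q for the presented algebra on the right.  Sending x^i_j to
-- F(ι_j)(π₁ x^i) defines Q → F(A): the Θ(x⃗_j) hold because π₁ identifies them, and the τ*(φ)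
-- hold because evaluating τ*(ε) there computes F applied to the evaluation of ε.  Conversely,
-- the x⃗_j span a copy of P₁ = F(Tm_X(1)) ≅ Tm_Y(κ)/Θ in Q, whose adjoint transpose is an element
-- g_j of G(Q).  The map A → G(Q), x_j ↦ g_j, respects φ since the transpose of ε evaluated at g
-- is again computed by τ*(ε), whose relations hold in Q; its transpose F(A) → Q inverts the
-- first map, as both composites fix generators.

open import Defs
open import Data.Unit using (⊤; tt)
open import Data.Product using (Σ; _×_; _,_; proj₁; proj₂)
open import Relation.Binary.Bundles using (Setoid)
open import Relation.Binary.Structures using (IsEquivalence)
import Relation.Binary.Reasoning.Setoid as SetoidReasoning

module _ {K : GQV} where

  Car : Model K → Set
  Car M = Algebra.Carrier (alg M)

  infix 4 [_]_≈_
  [_]_≈_ : (M : Model K) → Car M → Car M → Set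
  [ M ] x ≈ y = Algebra._≈_ (alg M) x y

  ≈-refl : (M : Model K) {x : Car M} → [ M ] x ≈ x
  ≈-refl M = Algebra.≈-refl (alg M)

  ≈-sym : (M : Model K) {x y : Car M} → [ M ] x ≈ y → [ M ] y ≈ x
  ≈-sym M = Algebra.≈-sym (alg M)

  ≈-trans : (M : Model K) {x y z : Car M} → [ M ] x ≈ y → [ M ] y ≈ z → [ M ] x ≈ z
  ≈-trans M = Algebra.≈-trans (alg M)

  setoid : Model K → Setoid _ _
  setoid M = record { isEquivalence = Algebra.isEquivalence (alg M) }

module ≈-Reasoning {K : GQV} (M : Model K) = SetoidReasoning (setoid M)

module _ {K : GQV} (M : Model K) where
  open ≈-Reasoning M

  eval-cong : ∀ {V} {ρ ρ' : V → Car M} → (∀ v → [ M ] ρ v ≈ ρ' v) →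
    ∀ t → [ M ] eval (alg M) ρ t ≈ eval (alg M) ρ' t
  eval-cong ρ≈ρ' (var v) = ρ≈ρ' v
  eval-cong ρ≈ρ' (op f ts) = Algebra.⟦⟧-cong (alg M) f (λ k → eval-cong ρ≈ρ' (ts k))

  eval-subst : ∀ {U V} (ρ : V → Car M) (σ : U → Term (sig K) V) → ∀ t →
    [ M ] eval (alg M) ρ (subst σ t) ≈ eval (alg M) (λ x → eval (alg M) ρ (σ x)) t
  eval-subst ρ σ (var x) = ≈-refl M
  eval-subst ρ σ (op f ts) = Algebra.⟦⟧-cong (alg M) f (λ k → eval-subst ρ σ (ts k))

  eval-respects-Cg : ∀ {V} {R : Term (sig K) V → Term (sig K) V → Set} (ρ : V → Car M) →
    (∀ {t u} → R t u → [ M ] eval (alg M) ρ t ≈ eval (alg M) ρ u) →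
    ∀ {t u} → Cg K R t u → [ M ] eval (alg M) ρ t ≈ eval (alg M) ρ u
  eval-respects-Cg ρ resp (base r) = resp r
  eval-respects-Cg ρ resp cg-refl = ≈-refl M
  eval-respects-Cg ρ resp (cg-sym e) = ≈-sym M (eval-respects-Cg ρ resp e)
  eval-respects-Cg ρ resp (cg-trans e e') =
    ≈-trans M (eval-respects-Cg ρ resp e) (eval-respects-Cg ρ resp e')
  eval-respects-Cg ρ resp (cg-compat f es) =
    Algebra.⟦⟧-cong (alg M) f (λ k → eval-respects-Cg ρ resp (es k))
  eval-respects-Cg ρ resp (cg-ax a σ prems) = begin
    eval (alg M) ρ (subst σ (conclL e))  ≈⟨ eval-subst ρ σ (conclL e) ⟩
    eval (alg M) ρσ (conclL e)           ≈⟨ sat M a ρσ prems′ ⟩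
    eval (alg M) ρσ (conclR e)           ≈⟨ eval-subst ρ σ (conclR e) ⟨
    eval (alg M) ρ (subst σ (conclR e))  ∎
    where
      e = axiom K a
      ρσ = λ x → eval (alg M) ρ (σ x)
      prems′ : ∀ p → [ M ] eval (alg M) ρσ (premL e p) ≈ eval (alg M) ρσ (premR e p)
      prems′ p = begin
        eval (alg M) ρσ (premL e p)           ≈⟨ eval-subst ρ σ (premL e p) ⟨
        eval (alg M) ρ (subst σ (premL e p))  ≈⟨ eval-respects-Cg ρ resp (prems p) ⟩
        eval (alg M) ρ (subst σ (premR e p))  ≈⟨ eval-subst ρ σ (premR e p) ⟩
        eval (alg M) ρσ (premR e p)           ∎

hom-eval : ∀ {K V} {M N : Model K} (h : MHom M N) (ρ : V → Car M) → ∀ t →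
  [ N ] fun h (eval (alg M) ρ t) ≈ eval (alg N) (λ v → fun h (ρ v)) t
hom-eval {N = N} h ρ (var x) = ≈-refl N
hom-eval {N = N} h ρ (op f ts) =
  ≈-trans N (fun-hom h f _) (Algebra.⟦⟧-cong (alg N) f (λ k → hom-eval h ρ (ts k)))

evalCgHom : ∀ K {V} {R : Term (sig K) V → Term (sig K) V → Set} (M : Model K) (ρ : V → Car M) →
  (∀ {t u} → R t u → [ M ] eval (alg M) ρ t ≈ eval (alg M) ρ u) → MHom (CgModel K R) M
evalCgHom K M ρ resp = record
  { fun = eval (alg M) ρ
  ; fun-cong = eval-respects-Cg M ρ resp
  ; fun-hom = λ f as → ≈-refl M }

eval-var : ∀ {S V} (c : Congruence S V) t → rel c (eval (TermAlg c) var t) t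
eval-var c (var x) = IsEquivalence.refl (isEquivalence c)
eval-var c (op f ts) = compat c f (λ k → eval-var c (ts k))

TermModel : ∀ {K V} (c : Congruence (sig K) V) →
  (∀ a → Satisfies (TermAlg c) (axiom K a)) → Model K
TermModel c s = record { alg = TermAlg c ; sat = s }

module _ {K V} {c : Congruence (sig K) V} {s : ∀ a → Satisfies (TermAlg c) (axiom K a)}
         {M : Model K} where

  hom≈eval-var : (h : MHom (TermModel c s) M) → ∀ t →
    [ M ] fun h t ≈ eval (alg M) (λ v → fun h (var v)) t
  hom≈eval-var h t =
    ≈-trans M (fun-cong h (IsEquivalence.sym (isEquivalence c) (eval-var c t))) (hom-eval h var t)

  hom-ext : (h h' : MHom (TermModel c s) M) →
    (∀ v → [ M ] fun h (var v) ≈ fun h' (var v)) → h ≐ h'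
  hom-ext h h' agree t =
    ≈-trans M (hom≈eval-var h t)
      (≈-trans M (eval-cong M agree t) (≈-sym M (hom≈eval-var h' t)))

point : ∀ {K} (M : Model K) → Car M → MHom (Tm K ⊤) M
point M a = evalHom _ M (λ _ → a)

point-cong : ∀ {K} (M : Model K) {a b : Car M} → [ M ] a ≈ b → point M a ≐ point M b
point-cong M a≈b = eval-cong M (λ _ → a≈b)

point-at-var : ∀ {K} {M : Model K} (h : MHom (Tm K ⊤) M) → point M (fun h (var tt)) ≐ h
point-at-var {M = M} h = hom-ext (point M (fun h (var tt))) h (λ _ → ≈-refl M)

module _ {K} {D P : Model K} (π : MHom D P)
         (π-surj : ∀ b → Σ (Car D) (λ d → [ P ] fun π d ≈ b)) where

  private
    pick : Car P → Car D
    pick b = proj₁ (π-surj b)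

    π-pick : ∀ b → [ P ] fun π (pick b) ≈ b
    π-pick b = proj₂ (π-surj b)

  module _ {Q : Model K} (s : MHom D Q)
           (ker⊆ker : ∀ {d d'} → [ P ] fun π d ≈ fun π d' → [ Q ] fun s d ≈ fun s d') where

    factor : MHom P Q
    factor = record
      { fun = λ b → fun s (pick b)
      ; fun-cong = λ {b} {b'} b≈b' →
          ker⊆ker (≈-trans P (π-pick b) (≈-trans P b≈b' (≈-sym P (π-pick b'))))
      ; fun-hom = λ f bs → ≈-trans Q (ker⊆ker (π-pick-hom f bs)) (fun-hom s f _) }
      where
        open ≈-Reasoning P
        π-pick-hom : ∀ f bs → [ P ] fun π (pick (Algebra.⟦_⟧ (alg P) f bs))
                                  ≈ fun π (Algebra.⟦_⟧ (alg D) f (λ k → pick (bs k)))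
        π-pick-hom f bs = begin
          fun π (pick (Algebra.⟦_⟧ (alg P) f bs))
            ≈⟨ π-pick _ ⟩
          Algebra.⟦_⟧ (alg P) f bs
            ≈⟨ Algebra.⟦⟧-cong (alg P) f (λ k → π-pick (bs k)) ⟨
          Algebra.⟦_⟧ (alg P) f (λ k → fun π (pick (bs k)))
            ≈⟨ fun-hom π f _ ⟨
          fun π (Algebra.⟦_⟧ (alg D) f (λ k → pick (bs k)))
            ∎

    factor-∘ : (factor ∘M π) ≐ s
    factor-∘ d = ker⊆ker (π-pick (fun π d))

  cancel-surjective : ∀ {Q} (h h' : MHom P Q) → (h ∘M π) ≐ (h' ∘M π) → h ≐ h'
  cancel-surjective {Q} h h' agree b = begin
    fun h b                  ≈⟨ fun-cong h (π-pick b) ⟨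
    fun h (fun π (pick b))   ≈⟨ agree (pick b) ⟩
    fun h' (fun π (pick b))  ≈⟨ fun-cong h' (π-pick b) ⟩
    fun h' b                 ∎
    where open ≈-Reasoning Q

module Adjunction {X Y : GQV} {F : Functor X Y} (adj : IsLeftAdjoint F) where
  open IsLeftAdjoint adj public
    renaming (φ to Φ; ψ to Ψ; φ-cong to Φ-cong; ψ-cong to Ψ-cong; ψφ to ΨΦ; φψ to ΦΨ)

  Φ-natˡ : ∀ {A A' B} (h : MHom (F₀ F A) B) (f : MHom A' A) → Φ (h ∘M F₁ F f) ≐ (Φ h ∘M f)
  Φ-natˡ {B = B} h f x =
    ≈-trans (F₀ G B) (Φ-cong {k = idM ∘M (h ∘M F₁ F f)} (λ _ → ≈-refl B) x)
      (≈-trans (F₀ G B) (natural f idM h x) (F-id G _))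

  Φ-natʳ : ∀ {A B B'} (g : MHom B B') (h : MHom (F₀ F A) B) → Φ (g ∘M h) ≐ (F₁ G g ∘M Φ h)
  Φ-natʳ {A} {B' = B'} g h x =
    ≈-trans (F₀ G B') (Φ-cong (λ y → fun-cong g (fun-cong h (≈-sym (F₀ F A) (F-id F y)))) x)
      (natural idM g h x)

  Ψ-natˡ : ∀ {A A' B} (m : MHom A (F₀ G B)) (f : MHom A' A) → Ψ (m ∘M f) ≐ (Ψ m ∘M F₁ F f)
  Ψ-natˡ {B = B} m f x = ≈-trans B (Ψ-cong m∘f≐Φ[Ψm∘Ff] x) (ΨΦ (Ψ m ∘M F₁ F f) x)
    where
      m∘f≐Φ[Ψm∘Ff] : (m ∘M f) ≐ Φ (Ψ m ∘M F₁ F f)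
      m∘f≐Φ[Ψm∘Ff] y =
        ≈-trans (F₀ G B) (≈-sym (F₀ G B) (ΦΨ m (fun f y))) (≈-sym (F₀ G B) (Φ-natˡ (Ψ m) f y))

  Ψ-natʳ : ∀ {A B B'} (g : MHom B B') (m : MHom A (F₀ G B)) → Ψ (F₁ G g ∘M m) ≐ (g ∘M Ψ m)
  Ψ-natʳ {B' = B'} g m x = ≈-trans B' (≈-sym B' (Ψ-cong Φ[g∘Ψm]≐Gg∘m x)) (ΨΦ (g ∘M Ψ m) x)
    where
      Φ[g∘Ψm]≐Gg∘m : Φ (g ∘M Ψ m) ≐ (F₁ G g ∘M m)
      Φ[g∘Ψm]≐Gg∘m y = ≈-trans (F₀ G B') (Φ-natʳ g (Ψ m) y) (fun-cong (F₁ G g) (ΦΨ m y))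

  Ψ-point-Φ : ∀ {B} (h : MHom (F₀ F (Tm X ⊤)) B) → Ψ (point (F₀ G B) (fun (Φ h) (var tt))) ≐ h
  Ψ-point-Φ {B} h x = ≈-trans B (Ψ-cong (point-at-var (Φ h)) x) (ΨΦ h x)

  Ψ-∘F-point : ∀ {M B} (m : MHom M (F₀ G B)) (a : Car M) y →
    [ B ] fun (Ψ m) (fun (F₁ F (point M a)) y) ≈ fun (Ψ (point (F₀ G B) (fun m a))) y
  Ψ-∘F-point {B = B} m a y =
    ≈-trans B (≈-sym B (Ψ-natˡ m (point _ a) y)) (Ψ-cong (hom-eval m (λ _ → a)) y)

  Ψ-point-injective : ∀ {B} {a b : Car (F₀ G B)} →
    Ψ (point (F₀ G B) a) ≐ Ψ (point (F₀ G B) b) → [ F₀ G B ] a ≈ b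
  Ψ-point-injective {B} {a} {b} Ψa≐Ψb = begin
    a                                        ≈⟨ ΦΨ (point (F₀ G B) a) (var tt) ⟨
    fun (Φ (Ψ (point (F₀ G B) a))) (var tt)  ≈⟨ Φ-cong Ψa≐Ψb (var tt) ⟩
    fun (Φ (Ψ (point (F₀ G B) b))) (var tt)  ≈⟨ ΦΨ (point (F₀ G B) b) (var tt) ⟩
    b                                        ∎
    where open ≈-Reasoning (F₀ G B)

module Translation {X Y : GQV} (F : Functor X Y) {κ : Set} (T : ContextualTranslation F κ) where

  P₁ : Model Y
  P₁ = F₀ F (Tm X ⊤)

  π : MHom (Tm Y κ) P₁
  π = π₁ T

  P₁-hom-ext : ∀ {M} (h h' : MHom P₁ M) →
    (∀ i → [ M ] fun h (fun π (var i)) ≈ fun h' (fun π (var i))) → h ≐ h'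
  P₁-hom-ext h h' agree =
    cancel-surjective π (π₁-surj T) h h' (hom-ext (h ∘M π) (h' ∘M π) agree)

  -- The valuation of π_n, with ι_j replaced by the point ρ j of M.
  lift : (M : Model X) {V : Set} → (V → Car M) → κ × V → Car (F₀ F M)
  lift M ρ (i , j) = fun (F₁ F (point M (ρ j))) (fun π (var i))

  eval-τ* : (M : Model X) {V : Set} (ρ : V → Car M) (ε : Term (sig X) V) (i : κ) →
    [ F₀ F M ] eval (alg (F₀ F M)) (lift M ρ) (τ* F T ε i)
             ≈ fun (F₁ F (point M (eval (alg M) ρ ε))) (fun π (var i))
  eval-τ* M ρ (var j) i = ≈-refl (F₀ F M)
  eval-τ* M ρ (op ψ as) i = begin
    ⟦ subst (λ (i′ , k) → τ* F T (as k) i′) (τ T ψ i) ⟧ (lift M ρ)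
      ≈⟨ eval-subst FM (lift M ρ) _ (τ T ψ i) ⟩
    ⟦ τ T ψ i ⟧ (λ (i′ , k) → ⟦ τ* F T (as k) i′ ⟧ (lift M ρ))
      ≈⟨ eval-cong FM (λ (i′ , k) → eval-τ* M ρ (as k) i′) (τ T ψ i) ⟩
    ⟦ τ T ψ i ⟧ (lift M ā)
      ≈⟨ eval-cong FM lift-via-ι (τ T ψ i) ⟩
    ⟦ τ T ψ i ⟧ (λ ik → fun (F₁ F evā) (fun (πHom F π n) (var ik)))
      ≈⟨ hom-eval (F₁ F evā) _ (τ T ψ i) ⟨
    fun (F₁ F evā) (fun (πHom F π n ∘M substHom Y (τ T ψ)) (var i))
      ≈⟨ fun-cong (F₁ F evā) (τ-spec T ψ (var i)) ⟩
    fun (F₁ F evā) (fun (F₁ F (opHom F ψ)) (fun π (var i)))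
      ≈⟨ F-∘ F evā (opHom F ψ) _ ⟨
    fun (F₁ F (evā ∘M opHom F ψ)) (fun π (var i))
      ≈⟨ F-cong F (eval-subst M ā _) _ ⟩
    fun (F₁ F (point M (eval (alg M) ρ (op ψ as)))) (fun π (var i))  ∎
    where
      open ≈-Reasoning (F₀ F M)
      FM = F₀ F M
      n = ar (sig X) ψ
      ⟦_⟧ : ∀ {W} → Term (sig Y) W → (W → Car FM) → Car FM
      ⟦ t ⟧ ρ′ = eval (alg FM) ρ′ t
      ā = λ k → eval (alg M) ρ (as k)
      evā = evalHom X M ā
      lift-via-ι : ∀ ik → [ FM ] lift M ā ik ≈ fun (F₁ F evā) (fun (πHom F π n) (var ik))
      lift-via-ι (i′ , k) =
        ≈-trans FM (F-cong F (λ t → ≈-sym M (eval-subst M ā _ t)) _) (F-∘ F evā (ιHom F k) _)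

  module _ (adj : IsLeftAdjoint F) where
    open Adjunction adj

    Ψ-τ* : (B : Model Y) {V : Set} (ρ : V → Car (F₀ G B)) (ε : Term (sig X) V) (i : κ) →
      [ B ] fun (Ψ (point (F₀ G B) (eval (alg (F₀ G B)) ρ ε))) (fun π (var i))
          ≈ eval (alg B) (λ (i′ , j) → fun (Ψ (point (F₀ G B) (ρ j))) (fun π (var i′))) (τ* F T ε i)
    Ψ-τ* B ρ ε i = begin
      fun (Ψ (point GB (eval (alg GB) ρ ε))) (fun π (var i))
        ≈⟨ Ψ-∘F-point idM (eval (alg GB) ρ ε) _ ⟨
      fun (Ψ idM) (fun (F₁ F (point GB (eval (alg GB) ρ ε))) (fun π (var i)))
        ≈⟨ fun-cong (Ψ idM) (eval-τ* GB ρ ε i) ⟨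
      fun (Ψ idM) (eval (alg (F₀ F GB)) (lift GB ρ) (τ* F T ε i))
        ≈⟨ hom-eval (Ψ idM) (lift GB ρ) (τ* F T ε i) ⟩
      eval (alg B) (λ ij → fun (Ψ idM) (lift GB ρ ij)) (τ* F T ε i)
        ≈⟨ eval-cong B (λ (i′ , j) → Ψ-∘F-point idM (ρ j) _) (τ* F T ε i) ⟩
      eval (alg B) (λ (i′ , j) → fun (Ψ (point GB (ρ j))) (fun π (var i′))) (τ* F T ε i)  ∎
      where
        open ≈-Reasoning B
        GB = F₀ G B

module Presentation {X Y : GQV} (F : Functor X Y) (adj : IsLeftAdjoint F)
                    {κ : Set} (T : ContextualTranslation F κ) {L : Set} (φ : KCongruence X L) where
  open Adjunction adj
  open Translation F T

  A : Model X
  A = quotModel φ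

  FA : Model Y
  FA = F₀ F A

  Q : Model Y
  Q = CgModel Y (Gen F T φ)

  GQ : Model X
  GQ = F₀ G Q

  column : L → Term (sig Y) κ → Term (sig Y) (κ × L)
  column j = subst (λ i → var (i , j))

  module _ (j : L) where
    private
      xⱼ : κ → Car Q
      xⱼ i = var (i , j)

      eval≈column : ∀ t → [ Q ] eval (alg Q) xⱼ t ≈ column j t
      eval≈column t =
        ≈-trans Q (≈-sym Q (eval-subst Q var _ t)) (eval-var (CgCong Y (Gen F T φ)) _)

      Θ-respected : ∀ {t u} → [ P₁ ] fun π t ≈ fun π u →
        [ Q ] eval (alg Q) xⱼ t ≈ eval (alg Q) xⱼ u
      Θ-respected {t} {u} πt≈πu =
        ≈-trans Q (eval≈column t) (≈-trans Q (base (gen-Θ j πt≈πu)) (≈-sym Q (eval≈column u)))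

    copy : MHom P₁ Q
    copy = factor π (π₁-surj T) (evalHom Y Q xⱼ) Θ-respected

    copy-π : ∀ i → [ Q ] fun copy (fun π (var i)) ≈ var (i , j)
    copy-π i = factor-∘ π (π₁-surj T) (evalHom Y Q xⱼ) Θ-respected (var i)

  from : MHom Q FA
  from = evalCgHom Y FA (lift A var) respects-Gen
    where
      open ≈-Reasoning FA

      eval-column : ∀ j t →
        [ FA ] eval (alg FA) (lift A var) (column j t) ≈ fun (F₁ F (point A (var j))) (fun π t)
      eval-column j t = ≈-trans FA (eval-subst FA (lift A var) _ t)
        (hom-ext (evalHom Y FA (λ i → lift A var (i , j))) (F₁ F (point A (var j)) ∘M π)
                 (λ _ → ≈-refl FA) t)

      respects-Gen : ∀ {t u} → Gen F T φ t u →
        [ FA ] eval (alg FA) (lift A var) t ≈ eval (alg FA) (lift A var) u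
      respects-Gen (gen-τ {ε} {δ} ε∼δ i) = begin
        eval (alg FA) (lift A var) (τ* F T ε i)                    ≈⟨ eval-τ* A var ε i ⟩
        fun (F₁ F (point A (eval (alg A) var ε))) (fun π (var i))  ≈⟨ F-cong F [ε]≐[δ] _ ⟩
        fun (F₁ F (point A (eval (alg A) var δ))) (fun π (var i))  ≈⟨ eval-τ* A var δ i ⟨
        eval (alg FA) (lift A var) (τ* F T δ i)                    ∎
        where
          [ε]≐[δ] = point-cong A
            (≈-trans A (eval-var (cong φ) ε) (≈-trans A ε∼δ (≈-sym A (eval-var (cong φ) δ))))
      respects-Gen (gen-Θ j {t} {u} πt≈πu) = begin
        eval (alg FA) (lift A var) (column j t)  ≈⟨ eval-column j t ⟩
        fun (F₁ F (point A (var j))) (fun π t)   ≈⟨ fun-cong (F₁ F (point A (var j))) πt≈πu ⟩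
        fun (F₁ F (point A (var j))) (fun π u)   ≈⟨ eval-column j u ⟨
        eval (alg FA) (lift A var) (column j u)  ∎

  gen : L → Car GQ
  gen j = fun (Φ (copy j)) (var tt)

  Ψ-point-gen : ∀ j i → [ Q ] fun (Ψ (point GQ (gen j))) (fun π (var i)) ≈ var (i , j)
  Ψ-point-gen j i = ≈-trans Q (Ψ-point-Φ (copy j) _) (copy-π j i)

  Ψ-point-eval-gen : ∀ ε i →
    [ Q ] fun (Ψ (point GQ (eval (alg GQ) gen ε))) (fun π (var i)) ≈ τ* F T ε i
  Ψ-point-eval-gen ε i = begin
    fun (Ψ (point GQ (eval (alg GQ) gen ε))) (fun π (var i))
      ≈⟨ Ψ-τ* adj Q gen ε i ⟩
    eval (alg Q) (λ (i′ , j) → fun (Ψ (point GQ (gen j))) (fun π (var i′))) (τ* F T ε i)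
      ≈⟨ eval-cong Q (λ (i′ , j) → Ψ-point-gen j i′) (τ* F T ε i) ⟩
    eval (alg Q) var (τ* F T ε i)
      ≈⟨ eval-var (CgCong Y (Gen F T φ)) (τ* F T ε i) ⟩
    τ* F T ε i
      ∎
    where open ≈-Reasoning Q

  eval-gen-respects-φ : ∀ {ε δ} → rel (cong φ) ε δ →
    [ GQ ] eval (alg GQ) gen ε ≈ eval (alg GQ) gen δ
  eval-gen-respects-φ {ε} {δ} ε∼δ =
    Ψ-point-injective (P₁-hom-ext (Ψ (point GQ [ε])) (Ψ (point GQ [δ])) λ i →
      ≈-trans Q (Ψ-point-eval-gen ε i)
        (≈-trans Q (base (gen-τ ε∼δ i)) (≈-sym Q (Ψ-point-eval-gen δ i))))
    where
      [ε] = eval (alg GQ) gen ε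
      [δ] = eval (alg GQ) gen δ

  A→GQ : MHom A GQ
  A→GQ = record
    { fun = eval (alg GQ) gen
    ; fun-cong = eval-gen-respects-φ
    ; fun-hom = λ f as → ≈-refl GQ }

  to : MHom FA Q
  to = Ψ A→GQ

  to∘from : (to ∘M from) ≐ idM
  to∘from = hom-ext (to ∘M from) idM λ (i , j) →
    ≈-trans Q (Ψ-∘F-point A→GQ (var j) (fun π (var i))) (Ψ-point-gen j i)

  from∘copy : ∀ j → (from ∘M copy j) ≐ F₁ F (point A (var j))
  from∘copy j = P₁-hom-ext (from ∘M copy j) (F₁ F (point A (var j))) λ i →
    fun-cong from (copy-π j i)

  G-from∘A→GQ : (F₁ G from ∘M A→GQ) ≐ Φ idM
  G-from∘A→GQ = hom-ext (F₁ G from ∘M A→GQ) (Φ idM) λ j → begin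
    fun (F₁ G from) (fun (Φ (copy j)) (var tt))       ≈⟨ Φ-natʳ from (copy j) (var tt) ⟨
    fun (Φ (from ∘M copy j)) (var tt)                 ≈⟨ Φ-cong (from∘copy j) (var tt) ⟩
    fun (Φ (idM ∘M F₁ F (point A (var j)))) (var tt)  ≈⟨ Φ-natˡ idM (point A (var j)) (var tt) ⟩
    fun (Φ idM) (var j)                               ∎
    where open ≈-Reasoning (F₀ G FA)

  from∘to : (from ∘M to) ≐ idM
  from∘to y = begin
    fun from (fun (Ψ A→GQ) y)      ≈⟨ Ψ-natʳ from A→GQ y ⟨
    fun (Ψ (F₁ G from ∘M A→GQ)) y  ≈⟨ Ψ-cong G-from∘A→GQ y ⟩
    fun (Ψ (Φ idM)) y              ≈⟨ ΨΦ idM y ⟩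
    y                              ∎
    where open ≈-Reasoning FA

  iso : ModelIso FA Q
  iso = record { to = to ; from = from ; from∘to = from∘to ; to∘from = to∘from }

-- Non-triviality of F is what makes a contextual translation exist.
corollary5p2 : (X Y : GQV) (F : Functor X Y) → IsLeftAdjoint F → NonTrivial F →
    (κ : Set) (T : ContextualTranslation F κ) (L : Set) (φ : KCongruence X L) →
    ModelIso (F₀ F (quotModel φ)) (CgModel Y (Gen F T φ))
corollary5p2 X Y F adj _ κ T L φ = Presentation.iso F adj T φ
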